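{- For any $\ell\geq 2$ and $n=2\ell+1$, if $D$ is a set of rainbow sequences such that $C(d)$ and $C(d')$ are edge-disjoint cycles in the graph $G_{n,2}^{C}$ for all $d,d'\in D$ with $d\neq d'$, then $|D|\leq n-3$.
   Context: Let $n=2\ell+1$ be odd. The graph $G_{n,2}^{C}$ has as vertices all 2-element subsets of $[n]=\{1,\dots,n\}$, with an edge between two subsets $A,B$ whenever $|A\setminus B|=|B\setminus A|=1$; the edge is labeled by the transposition $A\triangle B$. A (1-)rainbow cycle is a cycle along which every 2-element subset of $[n]$ appears exactly once as a transposition label. For $A\subseteq[n]$, $\sigma(A)$ is obtained by adding 1 to every element modulo $n$ (representatives $1,\dots,n$). For a pair $\{x,y\}$, $\mathrm{dist}(\{x,y\}):=\min\{y-x,x-y\}\in[\ell]$, differences taken modulo $n$. A sequence $d=(d_1,\dots,d_\ell)$ of integers with $-\ell\leq d_i\leq \ell$ is a rainbow sequence if, setting $b_1:=n$, $b_{i+1}:=b_i+d_i \bmod n$ for $i\in[\ell-1]$, and $B_i:=\{1,b_i\}$, the following hold: (a) $3\leq b_i\leq n$ for all $i\in[\ell]$ (and $b_1=n$); (b) $\{\mathrm{dist}(B_i)\mid i\in[\ell]\}=[\ell]$; (c) $\{\mathrm{dist}(B_i\triangle B_{i+1})\mid i\in[\ell-1]\}\cup\{\mathrm{dist}(B_\ell\triangle\sigma(B_1))\}=[\ell]$; and moreover $\mathrm{dist}(\{b_\ell,2\})=|d_\ell|$. For such $d$, with $B=(B_1,\dots,B_\ell)$, $C(d)$ denotes the cyclic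 sequence $(B,\sigma^1(B),\sigma^2(B),\dots,\sigma^{2\ell}(B))$, which is a rainbow Hamilton cycle in $G_{n,2}^{C}$. -}

module Defs where

open import Data.Nat as ℕ using (ℕ; zero; suc; _≤_; _⊓_; _⊔_; _%_; _∸_; _≟_)
open import Data.Integer as ℤ using (ℤ; +_; -_; ∣_∣; _%ℕ_)
open import Data.List using (List; []; _∷_; _++_; [_]; map; concatMap; filter; last; upTo; length)
open import Data.List.Membership.Propositional using (_∈_; _∉_)
open import Data.List.Membership.DecPropositional (_≟_) using (_∈?_)
open import Data.List.Relation.Unary.All using (All)
open import Data.Maybe using (Maybe; just)
open import Data.Product using (_×_; _,_; ∃₂)
open import Data.Sum using (_⊎_)
open import Relation.Binary.PropositionalEquality using (_≡_; _≢_)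
open import Relation.Nullary using (¬_; ¬?)
open import Function.Bundles using (_⇔_)

-- Elements of [n] are the naturals 1..n.
-- A 2-element subset {x,y} of [n] is stored canonically as (min x y , max x y),
-- so that equality of subsets is propositional equality of pairs.
Pair : Set
Pair = ℕ × ℕ

mk2 : ℕ → ℕ → Pair
mk2 x y = (x ⊓ y , x ⊔ y)

elems : Pair → List ℕ
elems (x , y) = x ∷ y ∷ []

symDiff : Pair → Pair → List ℕ
symDiff A B = filter (λ x → ¬? (x ∈? elems B)) (elems A)
           ++ filter (λ x → ¬? (x ∈? elems A)) (elems B)

distN : (n : ℕ) .{{_ : ℕ.NonZero n}} → ℕ → ℕ → ℕ
distN n x y = ((x ℕ.+ n ∸ y) % n) ⊓ ((y ℕ.+ n ∸ x) % n)

-- dist of a finite set: defined for 2-element sets; 0 (∉ [ℓ]) otherwise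
distSet : (n : ℕ) .{{_ : ℕ.NonZero n}} → List ℕ → ℕ
distSet n (x ∷ y ∷ []) = distN n x y
distSet n _            = 0

σ1 : (n : ℕ) .{{_ : ℕ.NonZero n}} → ℕ → ℕ
σ1 n x = suc (x % n)

σ : (n : ℕ) .{{_ : ℕ.NonZero n}} → Pair → Pair
σ n (x , y) = mk2 (σ1 n x) (σ1 n y)

σ^ : (n : ℕ) .{{_ : ℕ.NonZero n}} → ℕ → Pair → Pair
σ^ n zero    A = A
σ^ n (suc k) A = σ n (σ^ n k A)

-- b + d mod n with representatives 1..n
stepB : (n : ℕ) .{{_ : ℕ.NonZero n}} → ℕ → ℤ → ℕ
stepB n b d = suc ((((+ b) ℤ.+ d) ℤ.- (+ 1)) %ℕ n)

-- b_1 := start, b_{i+1} := b_i + d_i mod n; returns (b_1,…,b_k) for a list d of length k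
-- (the last entry of d is not used here)
bSeq : (n : ℕ) .{{_ : ℕ.NonZero n}} → ℕ → List ℤ → List ℕ
bSeq n b []       = []
bSeq n b (d ∷ ds) = b ∷ bSeq n (stepB n b d) ds

adj : {A : Set} → List A → List (A × A)
adj []           = []
adj (x ∷ [])     = []
adj (x ∷ y ∷ xs) = (x , y) ∷ adj (y ∷ xs)

cycAdj : {A : Set} → List A → List (A × A)
cycAdj []       = []
cycAdj (x ∷ xs) = adj (x ∷ xs ++ [ x ])

SetIsRange : List ℕ → ℕ → Set
SetIsRange L ℓ = ∀ k → (k ∈ L) ⇔ (1 ≤ k × k ≤ ℓ)

module _ (ℓ : ℕ) where

  nn : ℕ
  nn = suc (2 ℕ.* ℓ)

  bs : List ℤ → List ℕ
  bs d = bSeq nn nn d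

  Bs : List ℤ → List Pair
  Bs d = map (mk2 1) (bs d)

  IsRainbowSeq : List ℤ → Set
  IsRainbowSeq d =
      length d ≡ ℓ
    × All (λ z → (- (+ ℓ)) ℤ.≤ z × z ℤ.≤ (+ ℓ)) d
    × All (λ b → 3 ≤ b × b ≤ nn) (bs d)
    × SetIsRange (map (λ B → distSet nn (elems B)) (Bs d)) ℓ
    -- (c): B_i △ B_{i+1} for i < ℓ, and B_ℓ △ σ(B_1)
    × SetIsRange (map (λ p → distSet nn (symDiff (Data.Product.proj₁ p) (Data.Product.proj₂ p)))
                      (adj (Bs d ++ map (σ nn) (Data.List.take 1 (Bs d))))) ℓ
    × ∃₂ (λ bl dl → last (bs d) ≡ just bl × last d ≡ just dl × distN nn bl 2 ≡ ∣ dl ∣)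

  Cyc : List ℤ → List Pair
  Cyc d = concatMap (λ k → map (σ^ nn k) (Bs d)) (upTo nn)

  cycEdges : List ℤ → List (Pair × Pair)
  cycEdges d = cycAdj (Cyc d)

  SameEdge : Pair × Pair → Pair × Pair → Set
  SameEdge (u , v) (u' , v') = (u ≡ u' × v ≡ v') ⊎ (u ≡ v' × v ≡ u')

  EdgeDisjoint : List ℤ → List ℤ → Set
  EdgeDisjoint d d' = ∀ e e' → e ∈ cycEdges d → e' ∈ cycEdges d' → ¬ SameEdge e e'

module Submission where

-- Every cycle C(d) starts with the edge {1,n} — {1,b₂}, where b₂ = n + d₁ is the second
-- entry of the sequence b. Condition (a) gives 3 ≤ b₂ ≤ n, and b₂ ≠ n because otherwise
-- B₁ △ B₂ would be empty and its dist 0 would violate (c). Edge-disjoint cycles therefore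
-- have pairwise distinct values b₂ ∈ {3, …, n − 1}, so there are at most n − 3 of them.

open import Defs
open import Data.Nat using (ℕ; _≤_; _∸_)
open import Data.Integer using (ℤ)
open import Data.List using (List; length)
open import Data.List.Membership.Propositional using (_∈_)
open import Data.List.Relation.Unary.All using (All)
open import Data.List.Relation.Unary.Unique.Propositional using (Unique)
open import Relation.Binary.PropositionalEquality using (_≢_)

open import Data.Nat using (suc; _+_; _<_; z≤n; s≤s)
open import Data.Nat.Properties using (≤∧≢⇒<; m+[n∸m]≡n; ∸-monoˡ-<; module ≤-Reasoning)
open import Data.List using ([]; _∷_; _++_; map; filter; applyUpTo)
open import Data.List.Properties using (filter-none; length-map; length-applyUpTo; length-removeAt′)
open import Data.List.Relation.Unary.All as All using ([]; _∷_)
open import Data.List.Relation.Unary.All.Properties using (map⁺)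
open import Data.List.Relation.Unary.AllPairs using ([]; _∷_)
open import Data.List.Relation.Unary.Any using (here; there; _─_)
open import Data.List.Relation.Binary.Subset.Propositional using (_⊆_)
open import Data.List.Membership.Propositional.Properties using (∈-applyUpTo⁺)
open import Data.List.Membership.DecPropositional (Data.Nat._≟_) using (_∈?_)
open import Data.Product using (_×_; _,_)
open import Data.Sum using (inj₁)
open import Data.Empty using (⊥-elim)
open import Relation.Nullary using (¬?)
open import Relation.Binary.PropositionalEquality using (_≡_; refl; sym; cong; cong₂; subst)
open import Function.Bundles using (Equivalence)

∈-─⁺ : {A : Set} {x y : A} {ys : List A} (p : x ∈ ys) → y ∈ ys → y ≢ x → y ∈ (ys ─ p)
∈-─⁺ (here refl) (here refl) y≢x = ⊥-elim (y≢x refl)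
∈-─⁺ (here refl) (there y∈)  _   = y∈
∈-─⁺ (there p)   (here refl) _   = here refl
∈-─⁺ (there p)   (there y∈)  y≢x = there (∈-─⁺ p y∈ y≢x)

unique-⊆⇒length≤ : {A : Set} {xs ys : List A} → Unique xs → xs ⊆ ys → length xs ≤ length ys
unique-⊆⇒length≤ {xs = []}     _ _ = z≤n
unique-⊆⇒length≤ {xs = x ∷ xs} {ys} (x∉xs ∷ u) x∷xs⊆ys =
  subst (suc (length xs) ≤_) (sym (length-removeAt′ ys _))
    (s≤s (unique-⊆⇒length≤ u xs⊆ys─x))
  where
  x∈ys : x ∈ ys
  x∈ys = x∷xs⊆ys (here refl)
  xs⊆ys─x : xs ⊆ (ys ─ x∈ys)
  xs⊆ys─x y∈xs = ∈-─⁺ x∈ys (x∷xs⊆ys (there y∈xs)) (λ y≡x → All.lookup x∉xs y∈xs (sym y≡x))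

unique-bounded⇒length≤ : ∀ {a b} {xs : List ℕ} → Unique xs → All (λ x → a ≤ x × x < b) xs →
                         length xs ≤ b ∸ a
unique-bounded⇒length≤ {a} {b} {xs} u bounded = begin
  length xs                         ≤⟨ unique-⊆⇒length≤ u xs⊆range ⟩
  length (applyUpTo (a +_) (b ∸ a)) ≡⟨ length-applyUpTo (a +_) (b ∸ a) ⟩
  b ∸ a                             ∎
  where
  open ≤-Reasoning
  xs⊆range : xs ⊆ applyUpTo (a +_) (b ∸ a)
  xs⊆range {x} x∈xs with a≤x , x<b ← All.lookup bounded x∈xs =
    subst (_∈ applyUpTo (a +_) (b ∸ a)) (m+[n∸m]≡n a≤x) (∈-applyUpTo⁺ (a +_) (∸-monoˡ-< x<b a≤x))

unique-map⁺ : {A B : Set} {f : A → B} {xs : List A} →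
              (∀ {x y} → x ∈ xs → y ∈ xs → x ≢ y → f x ≢ f y) → Unique xs → Unique (map f xs)
unique-map⁺ {xs = []}     _   []         = []
unique-map⁺ {xs = x ∷ xs} inj (x∉xs ∷ u) =
  map⁺ (All.tabulate λ y∈xs → inj (here refl) (there y∈xs) (All.lookup x∉xs y∈xs))
  ∷ unique-map⁺ (λ x∈ y∈ → inj (there x∈) (there y∈)) u

symDiff-self : (A : Pair) → symDiff A A ≡ []
symDiff-self A = cong₂ _++_ no-elems-outside no-elems-outside
  where
  no-elems-outside : filter (λ x → ¬? (x ∈? elems A)) (elems A) ≡ []
  no-elems-outside = filter-none (λ x → ¬? (x ∈? elems A)) (All.tabulate λ x∈ x∉ → x∉ x∈)

secondB : ℕ → List ℤ → ℕ
secondB ℓ []      = 0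
secondB ℓ (d ∷ _) = stepB (nn ℓ) (nn ℓ) d

firstEdge : ℕ → List ℤ → Pair × Pair
firstEdge ℓ d = mk2 1 (nn ℓ) , mk2 1 (secondB ℓ d)

firstEdge-∈-cycEdges : ∀ {ℓ d} → 2 ≤ ℓ → IsRainbowSeq ℓ d → firstEdge ℓ d ∈ cycEdges ℓ d
firstEdge-∈-cycEdges {d = _ ∷ _ ∷ _}   _             _        = here refl
firstEdge-∈-cycEdges {d = []}          (s≤s (s≤s _)) (() , _)
firstEdge-∈-cycEdges {d = _ ∷ []}      (s≤s (s≤s _)) (() , _)

secondB-bounds : ∀ {ℓ d} → 2 ≤ ℓ → IsRainbowSeq ℓ d → 3 ≤ secondB ℓ d × secondB ℓ d < nn ℓ
secondB-bounds {d = []}     (s≤s (s≤s _)) (() , _)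
secondB-bounds {d = _ ∷ []} (s≤s (s≤s _)) (() , _)
secondB-bounds {ℓ} {d@(_ ∷ _ ∷ _)} _ (_ , _ , (_ ∷ (3≤b₂ , b₂≤n) ∷ _) , _ , rangeC , _) =
  3≤b₂ , ≤∧≢⇒< b₂≤n b₂≢n
  where
  B₁△B-empty : ∀ {b} → b ≡ nn ℓ → distSet (nn ℓ) (symDiff (mk2 1 (nn ℓ)) (mk2 1 b)) ≡ 0
  B₁△B-empty refl rewrite symDiff-self (mk2 1 (nn ℓ)) = refl
  b₂≢n : secondB ℓ d ≢ nn ℓ
  b₂≢n b₂≡n with () , _ ← Equivalence.to (rangeC 0) (here (sym (B₁△B-empty b₂≡n)))

secondB-injective : ∀ {ℓ d d'} → 2 ≤ ℓ → IsRainbowSeq ℓ d → IsRainbowSeq ℓ d' →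
                    EdgeDisjoint ℓ d d' → secondB ℓ d ≢ secondB ℓ d'
secondB-injective 2≤ℓ rd rd' disjoint b₂≡b₂' =
  disjoint _ _ (firstEdge-∈-cycEdges 2≤ℓ rd) (firstEdge-∈-cycEdges 2≤ℓ rd')
    (inj₁ (refl , cong (mk2 1) b₂≡b₂'))

theorem16 : (ℓ : ℕ) → 2 ≤ ℓ → (D : List (List ℤ)) → Unique D
    → All (IsRainbowSeq ℓ) D
    → (∀ d d' → d ∈ D → d' ∈ D → d ≢ d' → EdgeDisjoint ℓ d d')
    → length D ≤ nn ℓ ∸ 3
theorem16 ℓ 2≤ℓ D uniqueD rainbow disjoint = begin
  length D                   ≡⟨ length-map (secondB ℓ) D ⟨
  length (map (secondB ℓ) D) ≤⟨ unique-bounded⇒length≤ secondBs-unique secondBs-bounded ⟩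
  nn ℓ ∸ 3                   ∎
  where
  open ≤-Reasoning
  secondBs-unique : Unique (map (secondB ℓ) D)
  secondBs-unique = unique-map⁺
    (λ d∈ d'∈ d≢d' → secondB-injective 2≤ℓ (All.lookup rainbow d∈) (All.lookup rainbow d'∈)
                       (disjoint _ _ d∈ d'∈ d≢d'))
    uniqueD
  secondBs-bounded : All (λ b → 3 ≤ b × b < nn ℓ) (map (secondB ℓ) D)
  secondBs-bounded = map⁺ (All.map (secondB-bounds 2≤ℓ) rainbow)
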